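{- A weighted pushdown system $\mathcal{A}$ has a good cycle (i.e., some finite path in $\mathcal{A}$, starting from some configuration, is a good cycle) if and only if its summary graph $\mathrm{Gr}(\mathcal{A})$ has a positive simple cycle.
   Context: A weighted pushdown system (WPS) is $\mathcal{A}=\langle Q,\Gamma,q_0,E,w\rangle$: finite states $Q$, initial state $q_0$, finite stack alphabet $\Gamma$ with bottom symbol $\bot$ (never pushed or popped), finite edge set $E\subseteq(Q\times\Gamma)\times(Q\times\mathrm{Com}(\Gamma))$ with $\mathrm{Com}(\Gamma)=\{\mathit{skip},\mathit{pop}\}\cup\{\mathit{push}(z)\mid z\in\Gamma\}$, and $w:E\to\mathbb{Z}$. Configurations are $(\alpha,q)$, $\alpha\in\Gamma^+$ (last symbol is the top); $(\alpha',q')$ is a successor of $(\alpha,q)$ if some edge $(q,\gamma,q',\mathit{com})$ has $\gamma$ the top of $\alpha$ and $\alpha'=\mathit{com}(\alpha)$. A path is a sequence of configurations each a successor of the previous; its weight is the sum of edge weights. A configuration $(\alpha_i,q_i)$ of a path is a local minimum if $\alpha_i$ is a prefix of the stack string of every later configuration of the path. A good cycle is a finite path $\langle c_1,\dots,c_n\rangle$, $c_k=(\alpha_k,q_k)$, of positive weight such that $c_1$ is a local minimum, $q_1=q_n$ and $\alpha_1,\alpha_n$ have the same top symbol. A path is non-decreasing if its first configuration is a local minimum. The summary function $s:Q\times\Gamma\times Q\to\{ -\infty\}\cup\mathbb{Z}\cup\{\omega\}$: $s(q_1,\gamma,q_2)=\omega$ if for every $n$ there is a non-decreasing path from $(\bot\gamma,q_1)$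 to $(\bot\gamma,q_2)$ of weight $\ge n$; otherwise it is the maximum weight of such a path, or $-\infty$ if none exists. The summary graph $\mathrm{Gr}(\mathcal{A})$ has vertex set $Q\times\Gamma$ and edges of two kinds: skip-edges $((q_1,\gamma),(q_2,\gamma))$ whenever $s(q_1,\gamma,q_2)>-\infty$, with weight $s(q_1,\gamma,q_2)$; and push-edges $((q_1,\gamma_1),(q_2,\gamma_2))$ whenever $(q_1,\gamma_1,q_2,\mathit{push}(\gamma_2))\in E$, with the weight of that edge of $\mathcal{A}$. A simple cycle of $\mathrm{Gr}(\mathcal{A})$ is positive if it contains an edge of weight $\omega$ or the sum of its edge weights is positive. -}

module Defs where

open import Data.Nat using (ℕ)
open import Data.Fin using (Fin)
open import Data.Empty renaming (⊥ to Empty)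
open import Data.Bool using (Bool; true; false)
open import Data.Integer using (ℤ; _+_; _≤_; _<_; 0ℤ)
open import Data.List using (List; []; _∷_; _∷ʳ_; _++_)
open import Data.List.Relation.Unary.All using (All)
open import Data.List.Relation.Unary.Unique.Propositional using (Unique)
open import Data.Product using (Σ; ∃; _×_; _,_; proj₁)
open import Relation.Binary.PropositionalEquality using (_≡_)

data Com (nΓ : ℕ) : Set where
  skip : Com nΓ
  pop  : Com nΓ
  push : Fin nΓ → Com nΓ

-- The finite edge set E ⊆ (Q × Γ) × (Q × Com Γ) is given
-- by its characteristic function isEdge; w gives the weight of each
-- edge (its values on non-edges are irrelevant).

record WPS (nQ nΓ : ℕ) : Set where
  field
    q₀     : Fin nQ
    bot    : Fin nΓ
    isEdge : Fin nQ → Fin nΓ → Fin nQ → Com nΓ → Bool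
    w      : Fin nQ → Fin nΓ → Fin nQ → Com nΓ → ℤ
    noPushBot : ∀ q γ q' → isEdge q γ q' (push bot) ≡ false
    noPopBot  : ∀ q q' → isEdge q bot q' pop ≡ false

module _ {nQ nΓ : ℕ} (A : WPS nQ nΓ) where
  open WPS A

  Q Γ : Set
  Q = Fin nQ
  Γ = Fin nΓ

  -- Configurations (α, q) with α ∈ Γ⁺.  The stack string α is
  -- "below ∷ʳ top" (written bottom-first, the last symbol is the top).

  record Config : Set where
    constructor cfg
    field
      below : List Γ
      top   : Γ
      state : Q

  stackString : Config → List Γ
  stackString c = Config.below c ∷ʳ Config.top c

  _≼_ : List Γ → List Γ → Set
  α ≼ β = ∃ λ δ → β ≡ α ++ δ

  data Step : Config → Config → Set where
    skipS : ∀ {β γ q q'} → isEdge q γ q' skip ≡ true →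
            Step (cfg β γ q) (cfg β γ q')
    popS  : ∀ {β δ γ q q'} → isEdge q γ q' pop ≡ true →
            Step (cfg (β ∷ʳ δ) γ q) (cfg β δ q')
    pushS : ∀ {β γ z q q'} → isEdge q γ q' (push z) ≡ true →
            Step (cfg β γ q) (cfg (β ∷ʳ γ) z q')

  stepWeight : ∀ {c d} → Step c d → ℤ
  stepWeight (skipS {γ = γ} {q} {q'} _)         = w q γ q' skip
  stepWeight (popS {γ = γ} {q} {q'} _)          = w q γ q' pop
  stepWeight (pushS {γ = γ} {z} {q} {q'} _)     = w q γ q' (push z)

  data Path : Config → Config → Set where
    [_] : ∀ c → Path c c
    _◅_ : ∀ {c d e} → Step c d → Path d e → Path c e

  infixr 5 _◅_

  configs : ∀ {c d} → Path c d → List Config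
  configs [ c ]          = c ∷ []
  configs (_◅_ {c} s p)  = c ∷ configs p

  weight : ∀ {c d} → Path c d → ℤ
  weight [ c ]     = 0ℤ
  weight (s ◅ p)   = stepWeight s + weight p

  FirstIsLocalMin : ∀ {c d} → Path c d → Set
  FirstIsLocalMin {c} p = All (λ e → stackString c ≼ stackString e) (configs p)

  NonDecreasing : ∀ {c d} → Path c d → Set
  NonDecreasing = FirstIsLocalMin

  GoodCycle : ∀ {c d} → Path c d → Set
  GoodCycle {c} {d} p =
    0ℤ < weight p × FirstIsLocalMin p ×
    Config.state c ≡ Config.state d × Config.top c ≡ Config.top d

  HasGoodCycle : Set
  HasGoodCycle = Σ Config λ c → Σ Config λ d → Σ (Path c d) GoodCycle

  -- Summary function, given as its graph: values in ℤ ∪ {ω}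
  -- (the value -∞, "no path", is the absence of any value).

  data ℤω : Set where
    fin : ℤ → ℤω
    ω   : ℤω

  _⊕_ : ℤω → ℤω → ℤω
  fin a ⊕ fin b = fin (a + b)
  fin _ ⊕ ω     = ω
  ω     ⊕ _     = ω

  base : Γ → Q → Config
  base γ q = cfg (bot ∷ []) γ q

  IsSummary : Q → Γ → Q → ℤω → Set
  IsSummary q₁ γ q₂ ω =
    ∀ (n : ℤ) → Σ (Path (base γ q₁) (base γ q₂)) λ p →
      NonDecreasing p × n ≤ weight p
  IsSummary q₁ γ q₂ (fin k) =
    (Σ (Path (base γ q₁) (base γ q₂)) λ p → NonDecreasing p × weight p ≡ k) ×
    (∀ (p : Path (base γ q₁) (base γ q₂)) → NonDecreasing p → weight p ≤ k)

  Vertex : Set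
  Vertex = Q × Γ

  data GrEdge : Vertex → Vertex → ℤω → Set where
    skipE : ∀ {q₁ γ q₂} v → IsSummary q₁ γ q₂ v →
            GrEdge (q₁ , γ) (q₂ , γ) v
    pushE : ∀ {q₁ γ₁ q₂ γ₂} → isEdge q₁ γ₁ q₂ (push γ₂) ≡ true →
            GrEdge (q₁ , γ₁) (q₂ , γ₂) (fin (w q₁ γ₁ q₂ (push γ₂)))

  data GrWalk : Vertex → Vertex → Set where
    nil  : ∀ {u} → GrWalk u u
    cons : ∀ {u v x} {a : ℤω} → GrEdge u v a → GrWalk v x → GrWalk u x

  walkVertices : ∀ {u x} → GrWalk u x → List Vertex
  walkVertices nil                 = []
  walkVertices (cons {u} e p)      = u ∷ walkVertices p

  walkWeight : ∀ {u x} → GrWalk u x → ℤω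
  walkWeight nil                   = fin 0ℤ
  walkWeight (cons {a = a} e p)    = a ⊕ walkWeight p

  PositiveWeight : ℤω → Set
  PositiveWeight ω       = ω ≡ ω
  PositiveWeight (fin k) = 0ℤ < k

  IsSimpleCycle : ∀ {v} → GrWalk v v → Set
  IsSimpleCycle nil          = Empty
  IsSimpleCycle c@(cons _ _) = Unique (walkVertices c)

  HasPositiveSimpleCycle : Set
  HasPositiveSimpleCycle =
    Σ Vertex λ v → Σ (GrWalk v v) λ c →
      IsSimpleCycle c × PositiveWeight (walkWeight c)

module Submission where

-- A run that returns to its starting stack level is described by a
-- derivation tree (Deriv): skip steps and excursions push · run · pop.  A
-- non-decreasing path parses as an Ascent, i.e. derivations at increasing
-- levels joined by pushes, and derivations replay as paths at any level.
-- So a good cycle gives a positive closed walk of Gr(A) through skip- and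
-- push-edges, which contains a positive simple cycle (SimpleCycles); and a
-- positive simple cycle replays, edge by edge, as a good cycle (Directions).
--
-- The skip-edges need the value of the summary function on every triple
-- (q₁, γ, q₂) with a derivation.  By a pigeonhole argument on the spines of
-- derivation trees (Contexts, Excision), either a positive loop can be
-- pumped inside derivations of the triple, so the value is ω, or every
-- derivation is dominated by one of height at most the number of triples
-- (Reduction).  Enumerating the finitely many small trees and contexts
-- decides which case holds (Enumeration); in the second case the value is
-- the weight of the heaviest small derivation (Summaries).

open import Defs
open import Data.Nat as ℕ using (ℕ; zero; suc; _⊔_; _≤_; _<_; z≤n; s≤s)
import Data.Nat.Properties as ℕP
open import Data.Fin as F using (Fin; toℕ)
import Data.Fin.Properties as FP
open import Data.Bool using (Bool; true; false)
open import Data.Integer as ℤ using (ℤ; _+_; _-_; 0ℤ; ∣_∣)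
import Data.Integer.Properties as ℤP
open import Data.Integer.Tactic.RingSolver using (solve-∀)
open import Data.Unit using (⊤; tt)
open import Data.Empty using (⊥-elim)
open import Data.List using (List; []; _∷_; _∷ʳ_; _++_; length; map; concatMap; allFin)
import Data.List.Properties as LP
open import Data.List.Relation.Unary.All as All using (All; []; _∷_)
open import Data.List.Relation.Unary.All.Properties.Core using (¬Any⇒All¬)
open import Data.List.Relation.Unary.Any as Any using (Any; here; there; any?)
open import Data.List.Relation.Unary.AllPairs using ([]; _∷_)
open import Data.List.Relation.Unary.Unique.Propositional using (Unique)
open import Data.List.Membership.Propositional using (_∈_; lose)
open import Data.List.Membership.Propositional.Properties
  using (∈-++⁺ˡ; ∈-++⁺ʳ; ∈-map⁺; ∈-concatMap⁺; ∈-allFin)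
open import Data.List.Extrema ℤP.≤-totalOrder using (argmax; f[⊥]≤f[argmax]; f[xs]≤f[argmax])
open import Data.Product using (Σ; ∃; _×_; _,_; proj₁; proj₂; uncurry)
open import Data.Product.Properties using (≡-dec)
open import Data.Sum using (_⊎_; inj₁; inj₂)
open import Function.Bundles using (_⇔_; mk⇔)
open import Relation.Nullary using (¬_; Dec; yes; no; contradiction)
open import Relation.Nullary.Decidable using (_×-dec_)
open import Relation.Binary.PropositionalEquality

regroup-after : ∀ a b c d e → a + (b + (c + (d + e))) ≡ a + (b + (c + d)) + e
regroup-after = solve-∀

regroup-inside : ∀ a b c d e → a + ((b + e) + (c + d)) ≡ a + (b + (c + d)) + e
regroup-inside = solve-∀

regroup-climb : ∀ a b c d → a + (b + (c + d)) ≡ a + (b + c) + d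
regroup-climb = solve-∀

swap-+ : ∀ a b c → a + (b + c) ≡ b + (a + c)
swap-+ = solve-∀

module Prefix {X : Set} where

  IsPrefix : List X → List X → Set
  IsPrefix α β = ∃ λ δ → β ≡ α ++ δ

  prefix-refl : ∀ α → IsPrefix α α
  prefix-refl α = [] , sym (LP.++-identityʳ α)

  prefix-trans : ∀ {α β γ} → IsPrefix α β → IsPrefix β γ → IsPrefix α γ
  prefix-trans {α} (δ , refl) (δ' , refl) = δ ++ δ' , LP.++-assoc α δ δ'

  prefix-snoc : ∀ α (x : X) → IsPrefix α (α ∷ʳ x)
  prefix-snoc α x = x ∷ [] , refl

  length-snoc : ∀ α (x : X) → length (α ∷ʳ x) ≡ suc (length α)
  length-snoc α x = trans (LP.length-++ α) (ℕP.+-comm (length α) 1)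

  -- A list is never a prefix of a strictly shorter one; used to rule out
  -- that a non-decreasing path pops below its starting level.
  snoc-not-prefix : ∀ α (x : X) → ¬ IsPrefix (α ∷ʳ x) α
  snoc-not-prefix α x (δ , eq) = ℕP.<-irrefl refl (begin
      suc (length α)        ≡⟨ sym (length-snoc α x) ⟩
      length (α ∷ʳ x)       ≤⟨ ℕP.m≤m+n _ (length δ) ⟩
      length (α ∷ʳ x) ℕ.+ length δ ≡⟨ sym (LP.length-++ (α ∷ʳ x)) ⟩
      length ((α ∷ʳ x) ++ δ) ≡⟨ cong length (sym eq) ⟩
      length α ∎)
    where open ℕP.≤-Reasoning
open Prefix

module Derivations {nQ nΓ : ℕ} (A : WPS nQ nΓ) where
  open WPS A

  -- (q, γ, q') indexes the runs from state q to state q' that start and end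
  -- with the same stack and γ on top: the arguments of the summary function.
  Triple : Set
  Triple = Fin nQ × Fin nΓ × Fin nQ

  -- Such a run is a sequence of skip steps and excursions
  -- push z · (run with z on top, one level higher) · pop.
  data Deriv : Triple → Set where
    stay      : ∀ {q γ} → Deriv (q , γ , q)
    skipD     : ∀ {q γ q₁ q₂} → isEdge q γ q₁ skip ≡ true →
                Deriv (q₁ , γ , q₂) → Deriv (q , γ , q₂)
    excursion : ∀ {q γ q₁ z q₂ q₃ q₄} → isEdge q γ q₁ (push z) ≡ true →
                Deriv (q₁ , z , q₂) → isEdge q₂ z q₃ pop ≡ true →
                Deriv (q₃ , γ , q₄) → Deriv (q , γ , q₄)

  dweight : ∀ {X} → Deriv X → ℤ
  dweight stay = 0ℤ
  dweight (skipD {q} {γ} {q₁} _ d) = w q γ q₁ skip + dweight d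
  dweight (excursion {q} {γ} {q₁} {z} {q₂} {q₃} _ d _ d') =
    w q γ q₁ (push z) + (dweight d + (w q₂ z q₃ pop + dweight d'))

  _++D_ : ∀ {q γ q₁ q₂} → Deriv (q , γ , q₁) → Deriv (q₁ , γ , q₂) → Deriv (q , γ , q₂)
  stay ++D d' = d'
  skipD e d ++D d' = skipD e (d ++D d')
  excursion e d e' d₂ ++D d' = excursion e d e' (d₂ ++D d')

  dweight-++ : ∀ {q γ q₁ q₂} (d : Deriv (q , γ , q₁)) (d' : Deriv (q₁ , γ , q₂)) →
               dweight (d ++D d') ≡ dweight d + dweight d'
  dweight-++ stay d' = sym (ℤP.+-identityˡ _)
  dweight-++ (skipD {q} {γ} {q₁} e d) d' rewrite dweight-++ d d' =
    sym (ℤP.+-assoc (w q γ q₁ skip) (dweight d) (dweight d'))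
  dweight-++ (excursion {q} {γ} {q₁} {z} {q₂} {q₃} e d e' d₂) d' rewrite dweight-++ d₂ d' =
    regroup-after (w q γ q₁ (push z)) (dweight d) (w q₂ z q₃ pop) (dweight d₂) (dweight d')

  _++P_ : ∀ {c d e} → Path A c d → Path A d e → Path A c e
  [ c ] ++P p = p
  (s ◅ p) ++P p' = s ◅ (p ++P p')

  weight-++ : ∀ {c d e} (p : Path A c d) (p' : Path A d e) →
              weight A (p ++P p') ≡ weight A p + weight A p'
  weight-++ [ c ] p' = sym (ℤP.+-identityˡ _)
  weight-++ (s ◅ p) p' rewrite weight-++ p p' =
    sym (ℤP.+-assoc (stepWeight A s) (weight A p) (weight A p'))

  all-++P : ∀ {P : Config A → Set} {c d e} (p : Path A c d) (p' : Path A d e) →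
            All P (configs A p) → All P (configs A p') → All P (configs A (p ++P p'))
  all-++P [ c ] p' _ all' = all'
  all-++P (s ◅ p) p' (x ∷ all) all' = x ∷ all-++P p p' all all'

  Above : List (Fin nΓ) → Config A → Set
  Above π c = IsPrefix π (stackString A c)

  derivPath : ∀ (β : List (Fin nΓ)) {q γ q₂} (d : Deriv (q , γ , q₂)) →
    Σ (Path A (cfg β γ q) (cfg β γ q₂)) λ p →
      weight A p ≡ dweight d × All (Above (β ∷ʳ γ)) (configs A p)
  derivPath β {q} {γ} stay = [ cfg β γ q ] , refl , prefix-refl (β ∷ʳ γ) ∷ []
  derivPath β {q} {γ} (skipD {q₁ = q₁} e d) with derivPath β d
  ... | p , wp , above = skipS e ◅ p , cong (w q γ q₁ skip +_) wp , prefix-refl (β ∷ʳ γ) ∷ above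
  derivPath β {q} {γ} (excursion {q₁ = q₁} {z} {q₂} {q₃} e d e' d')
    with derivPath (β ∷ʳ γ) d | derivPath β d'
  ... | p , wp , above | p' , wp' , above' =
    pushS e ◅ (p ++P (popS e' ◅ p')) ,
    cong (w q γ q₁ (push z) +_)
      (trans (weight-++ p (popS e' ◅ p')) (cong₂ _+_ wp (cong (w q₂ z q₃ pop +_) wp'))) ,
    prefix-refl (β ∷ʳ γ) ∷ all-++P p (popS e' ◅ p')
      (All.map (prefix-trans (prefix-snoc (β ∷ʳ γ) _)) above)
      (prefix-snoc (β ∷ʳ γ) _ ∷ above')

  all-first : ∀ {P : Config A → Set} {c d} (p : Path A c d) → All P (configs A p) → P c
  all-first [ _ ] (x ∷ _) = x
  all-first (_ ◅ _) (x ∷ _) = x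

  -- A non-decreasing path from (β ∷ʳ γ, q) to c splits at its last visits
  -- to the levels it climbs through: a derivation at level β, then either
  -- the end (c is at level β) or a push followed by an ascent one level up.
  data Ascent (β : List (Fin nΓ)) : Fin nQ → Fin nΓ → Config A → Set where
    level : ∀ {q γ q₁} → Deriv (q , γ , q₁) → Ascent β q γ (cfg β γ q₁)
    climb : ∀ {q γ q₁ q₂ z c} → Deriv (q , γ , q₁) → isEdge q₁ γ q₂ (push z) ≡ true →
            Ascent (β ∷ʳ γ) q₂ z c → Ascent β q γ c

  aweight : ∀ {β q γ c} → Ascent β q γ c → ℤ
  aweight (level d) = dweight d
  aweight (climb {γ = γ} {q₁} {q₂} {z} d e u) = dweight d + (w q₁ γ q₂ (push z) + aweight u)

  record Dropped (β : List (Fin nΓ)) (q : Fin nQ) (γ : Fin nΓ) (c : Config A) (k : ℤ) : Set where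
    field
      {rest}   : List (Fin nΓ)
      {δ}      : Fin nΓ
      {q₁ q₂}  : Fin nQ
      base≡    : β ≡ rest ∷ʳ δ
      target≡  : c ≡ cfg rest δ q₂
      deriv    : Deriv (q , γ , q₁)
      popEdge  : isEdge q₁ γ q₂ pop ≡ true
      weight≡  : dweight deriv + w q₁ γ q₂ pop ≡ k

  extend : ∀ {β q γ c c'} (u : Ascent β q γ c) (s : Step A c c') →
    (Σ (Ascent β q γ c') λ u' → aweight u' ≡ aweight u + stepWeight A s) ⊎
    Dropped β q γ c' (aweight u + stepWeight A s)
  extend (level {q₁ = q₁} d) (skipS {γ = γ} {q' = q₂} e) =
    inj₁ (level (d ++D skipD e stay) ,
          trans (dweight-++ d (skipD e stay)) (cong (dweight d +_) (ℤP.+-identityʳ (w q₁ γ q₂ skip))))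
  extend (level {q₁ = q₁} d) (pushS {γ = γ} {z} {q' = q₂} e) =
    inj₁ (climb d e (level stay) , cong (dweight d +_) (ℤP.+-identityʳ (w q₁ γ q₂ (push z))))
  extend (level d) (popS e) =
    inj₂ (record { base≡ = refl ; target≡ = refl ; deriv = d ; popEdge = e ; weight≡ = refl })
  extend {β} (climb {γ = γ} {q₁} {q₂} {z} d e u) s with extend u s
  ... | inj₁ (u' , eq) =
    inj₁ (climb d e u' , trans (cong (λ t → dweight d + (w q₁ γ q₂ (push z) + t)) eq)
                               (regroup-climb (dweight d) (w q₁ γ q₂ (push z)) (aweight u) (stepWeight A s)))
  ... | inj₂ record { base≡ = base≡ ; target≡ = refl ; deriv = d' ; popEdge = e' ; weight≡ = weight≡ }
    with LP.∷ʳ-injective β _ base≡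
  ... | refl , refl =
    inj₁ (level (d ++D excursion e d' e' stay) ,
          trans (dweight-++ d (excursion e d' e' stay))
                (trans (cong (λ t → dweight d + (w q₁ γ q₂ (push z) + t))
                             (trans (cong (dweight d' +_) (ℤP.+-identityʳ _)) weight≡))
                       (regroup-climb (dweight d) (w q₁ γ q₂ (push z)) (aweight u) (stepWeight A s))))

  extendAlong : ∀ {β q γ c e} (u : Ascent β q γ c) (p : Path A c e) →
    All (Above (β ∷ʳ γ)) (configs A p) → Σ (Ascent β q γ e) λ u' → aweight u' ≡ aweight u + weight A p
  extendAlong u [ c ] _ = u , sym (ℤP.+-identityʳ _)
  extendAlong u (s ◅ p) (_ ∷ above) with extend u s
  ... | inj₁ (u' , eq) with extendAlong u' p above
  ...   | u'' , eq' = u'' , trans eq' (trans (cong (_+ weight A p) eq)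
                                            (ℤP.+-assoc (aweight u) (stepWeight A s) (weight A p)))
  extendAlong {β} {γ = γ} u (s ◅ p) (_ ∷ above)
    | inj₂ record { base≡ = base≡ ; target≡ = refl } =
    ⊥-elim (snoc-not-prefix β γ (subst (IsPrefix (β ∷ʳ γ)) (sym base≡) (all-first p above)))

  parse : ∀ {β q γ e} (p : Path A (cfg β γ q) e) → NonDecreasing A p →
    Σ (Ascent β q γ e) λ u → aweight u ≡ weight A p
  parse p nd with extendAlong (level stay) p nd
  ... | u , eq = u , trans eq (ℤP.+-identityˡ _)

  ascentLevel : ∀ {β q γ c} → Ascent β q γ c → length β ℕ.≤ length (Config.below c)
  ascentLevel (level d) = ℕP.≤-refl
  ascentLevel {β} {γ = γ} (climb d e u) =
    ℕP.≤-trans (ℕP.n≤1+n _) (subst (_≤ _) (length-snoc β γ) (ascentLevel u))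

  flatAscent : ∀ {β q γ q'} (u : Ascent β q γ (cfg β γ q')) →
    Σ (Deriv (q , γ , q')) λ d → dweight d ≡ aweight u
  flatAscent (level d) = d , refl
  flatAscent {β} {γ = γ} (climb d e u) =
    ⊥-elim (ℕP.<-irrefl refl (subst (_≤ length β) (length-snoc β γ) (ascentLevel u)))

module Contexts {nQ nΓ : ℕ} (A : WPS nQ nΓ) where
  open WPS A
  open Derivations A

  -- A context Ctx X Y is a derivation of X in which one subderivation of Y,
  -- reached through the spine of nodes above it, has been removed.
  data Ctx : Triple → Triple → Set where
    hole     : ∀ {X} → Ctx X X
    skipC    : ∀ {q γ q₁ q₂ Y} → isEdge q γ q₁ skip ≡ true →
               Ctx (q₁ , γ , q₂) Y → Ctx (q , γ , q₂) Y
    inside   : ∀ {q γ q₁ z q₂ q₃ q₄ Y} → isEdge q γ q₁ (push z) ≡ true →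
               Ctx (q₁ , z , q₂) Y → isEdge q₂ z q₃ pop ≡ true →
               Deriv (q₃ , γ , q₄) → Ctx (q , γ , q₄) Y
    after    : ∀ {q γ q₁ z q₂ q₃ q₄ Y} → isEdge q γ q₁ (push z) ≡ true →
               Deriv (q₁ , z , q₂) → isEdge q₂ z q₃ pop ≡ true →
               Ctx (q₃ , γ , q₄) Y → Ctx (q , γ , q₄) Y

  plug : ∀ {X Y} → Ctx X Y → Deriv Y → Deriv X
  plug hole t = t
  plug (skipC e C) t = skipD e (plug C t)
  plug (inside e C e' d) t = excursion e (plug C t) e' d
  plug (after e d e' C) t = excursion e d e' (plug C t)

  _∘C_ : ∀ {X Y Z} → Ctx X Y → Ctx Y Z → Ctx X Z
  hole ∘C C' = C'
  skipC e C ∘C C' = skipC e (C ∘C C')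
  inside e C e' d ∘C C' = inside e (C ∘C C') e' d
  after e d e' C ∘C C' = after e d e' (C ∘C C')

  infixr 9 _∘C_

  cweight : ∀ {X Y} → Ctx X Y → ℤ
  cweight hole = 0ℤ
  cweight (skipC {q} {γ} {q₁} _ C) = w q γ q₁ skip + cweight C
  cweight (inside {q} {γ} {q₁} {z} {q₂} {q₃} _ C _ d) =
    w q γ q₁ (push z) + (cweight C + (w q₂ z q₃ pop + dweight d))
  cweight (after {q} {γ} {q₁} {z} {q₂} {q₃} _ d _ C) =
    w q γ q₁ (push z) + (dweight d + (w q₂ z q₃ pop + cweight C))

  spine : ∀ {X Y} → Ctx X Y → ℕ
  spine hole = 0
  spine (skipC _ C) = suc (spine C)
  spine (inside _ C _ _) = suc (spine C)
  spine (after _ _ _ C) = suc (spine C)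

  dsize : ∀ {X} → Deriv X → ℕ
  dsize stay = 0
  dsize (skipD _ d) = suc (dsize d)
  dsize (excursion _ d _ d') = suc (dsize d ℕ.+ dsize d')

  csize : ∀ {X Y} → Ctx X Y → ℕ
  csize hole = 0
  csize (skipC _ C) = suc (csize C)
  csize (inside _ C _ d) = suc (csize C ℕ.+ dsize d)
  csize (after _ d _ C) = suc (dsize d ℕ.+ csize C)

  height : ∀ {X} → Deriv X → ℕ
  height stay = 0
  height (skipD _ d) = suc (height d)
  height (excursion _ d _ d') = suc (height d ⊔ height d')

  dweight-plug : ∀ {X Y} (C : Ctx X Y) t → dweight (plug C t) ≡ cweight C + dweight t
  dweight-plug hole t = sym (ℤP.+-identityˡ _)
  dweight-plug (skipC {q} {γ} {q₁} e C) t rewrite dweight-plug C t =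
    sym (ℤP.+-assoc (w q γ q₁ skip) (cweight C) (dweight t))
  dweight-plug (inside {q} {γ} {q₁} {z} {q₂} {q₃} e C e' d) t rewrite dweight-plug C t =
    regroup-inside (w q γ q₁ (push z)) (cweight C) (w q₂ z q₃ pop) (dweight d) (dweight t)
  dweight-plug (after {q} {γ} {q₁} {z} {q₂} {q₃} e d e' C) t rewrite dweight-plug C t =
    regroup-after (w q γ q₁ (push z)) (dweight d) (w q₂ z q₃ pop) (cweight C) (dweight t)

  dsize-plug : ∀ {X Y} (C : Ctx X Y) t → dsize (plug C t) ≡ csize C ℕ.+ dsize t
  dsize-plug hole t = refl
  dsize-plug (skipC e C) t = cong suc (dsize-plug C t)
  dsize-plug (inside e C e' d) t rewrite dsize-plug C t =
    cong suc (trans (ℕP.+-assoc (csize C) (dsize t) (dsize d))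
             (trans (cong (csize C ℕ.+_) (ℕP.+-comm (dsize t) (dsize d)))
                    (sym (ℕP.+-assoc (csize C) (dsize d) (dsize t)))))
  dsize-plug (after e d e' C) t rewrite dsize-plug C t =
    cong suc (sym (ℕP.+-assoc (dsize d) (csize C) (dsize t)))

  plug-∘ : ∀ {X Y Z} (C : Ctx X Y) (C' : Ctx Y Z) t → plug (C ∘C C') t ≡ plug C (plug C' t)
  plug-∘ hole C' t = refl
  plug-∘ (skipC e C) C' t = cong (skipD e) (plug-∘ C C' t)
  plug-∘ (inside e C e' d) C' t = cong (λ x → excursion e x e' d) (plug-∘ C C' t)
  plug-∘ (after e d e' C) C' t = cong (excursion e d e') (plug-∘ C C' t)

  cweight-∘ : ∀ {X Y Z} (C : Ctx X Y) (C' : Ctx Y Z) → cweight (C ∘C C') ≡ cweight C + cweight C'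
  cweight-∘ hole C' = sym (ℤP.+-identityˡ _)
  cweight-∘ (skipC {q} {γ} {q₁} e C) C' rewrite cweight-∘ C C' =
    sym (ℤP.+-assoc (w q γ q₁ skip) (cweight C) (cweight C'))
  cweight-∘ (inside {q} {γ} {q₁} {z} {q₂} {q₃} e C e' d) C' rewrite cweight-∘ C C' =
    regroup-inside (w q γ q₁ (push z)) (cweight C) (w q₂ z q₃ pop) (dweight d) (cweight C')
  cweight-∘ (after {q} {γ} {q₁} {z} {q₂} {q₃} e d e' C) C' rewrite cweight-∘ C C' =
    regroup-after (w q γ q₁ (push z)) (dweight d) (w q₂ z q₃ pop) (cweight C) (cweight C')

  spine-∘ : ∀ {X Y Z} (C : Ctx X Y) (C' : Ctx Y Z) → spine (C ∘C C') ≡ spine C ℕ.+ spine C'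
  spine-∘ hole C' = refl
  spine-∘ (skipC e C) C' = cong suc (spine-∘ C C')
  spine-∘ (inside e C e' d) C' = cong suc (spine-∘ C C')
  spine-∘ (after e d e' C) C' = cong suc (spine-∘ C C')

  spine≤csize : ∀ {X Y} (C : Ctx X Y) → spine C ≤ csize C
  spine≤csize hole = z≤n
  spine≤csize (skipC e C) = s≤s (spine≤csize C)
  spine≤csize (inside e C e' d) = s≤s (ℕP.≤-trans (spine≤csize C) (ℕP.m≤m+n _ _))
  spine≤csize (after e d e' C) = s≤s (ℕP.≤-trans (spine≤csize C) (ℕP.m≤n+m _ _))

  deep : ∀ {X} (k : ℕ) (d : Deriv X) → k ≤ height d →
    Σ Triple λ Y → Σ (Ctx X Y) λ C → Σ (Deriv Y) λ t → spine C ≡ k × plug C t ≡ d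
  deep zero d _ = _ , hole , d , refl , refl
  deep (suc k) (skipD e d) (s≤s k≤h) with deep k d k≤h
  ... | Y , C , t , sp , eq = Y , skipC e C , t , cong suc sp , cong (skipD e) eq
  deep (suc k) (excursion e d e' d') (s≤s k≤h) with k ℕ.≤? height d
  ... | yes k≤hd with deep k d k≤hd
  ...   | Y , C , t , sp , eq = Y , inside e C e' d' , t , cong suc sp , cong (λ x → excursion e x e' d') eq
  deep (suc k) (excursion e d e' d') (s≤s k≤h) | no k≰hd with deep k d' k≤hd'
    where k≤hd' : k ≤ height d'
          k≤hd' with ℕP.⊔-sel (height d) (height d')
          ... | inj₁ eq = contradiction (subst (k ≤_) eq k≤h) k≰hd
          ... | inj₂ eq = subst (k ≤_) eq k≤h
  ...   | Y , C , t , sp , eq = Y , after e d e' C , t , cong suc sp , cong (excursion e d e') eq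

  tripleAt : ∀ {X Y} → Ctx X Y → ℕ → Triple
  tripleAt {X} C zero = X
  tripleAt {X} hole (suc k) = X
  tripleAt (skipC _ C) (suc k) = tripleAt C k
  tripleAt (inside _ C _ _) (suc k) = tripleAt C k
  tripleAt (after _ _ _ C) (suc k) = tripleAt C k

  cut : ∀ {X Y} (C : Ctx X Y) (k : ℕ) → k ≤ spine C →
    Σ (Ctx X (tripleAt C k)) λ C₁ → Σ (Ctx (tripleAt C k) Y) λ C₂ → C ≡ C₁ ∘C C₂ × spine C₁ ≡ k
  cut C zero _ = hole , C , refl , refl
  cut (skipC e C) (suc k) (s≤s k≤) with cut C k k≤
  ... | C₁ , C₂ , eq , sp = skipC e C₁ , C₂ , cong (skipC e) eq , cong suc sp
  cut (inside e C e' d) (suc k) (s≤s k≤) with cut C k k≤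
  ... | C₁ , C₂ , eq , sp = inside e C₁ e' d , C₂ , cong (λ x → inside e x e' d) eq , cong suc sp
  cut (after e d e' C) (suc k) (s≤s k≤) with cut C k k≤
  ... | C₁ , C₂ , eq , sp = after e d e' C₁ , C₂ , cong (after e d e') eq , cong suc sp

  cutTwice : ∀ {X Y} (C : Ctx X Y) (i j : ℕ) → i ≤ j → j ≤ spine C →
    Σ (Ctx X (tripleAt C i)) λ C₁ → Σ (Ctx (tripleAt C i) (tripleAt C j)) λ B →
    Σ (Ctx (tripleAt C j) Y) λ C₃ → C ≡ C₁ ∘C (B ∘C C₃) × spine C₁ ≡ i × spine C₁ ℕ.+ spine B ≡ j
  cutTwice C zero j _ j≤ with cut C j j≤
  ... | B , C₃ , eq , sp = hole , B , C₃ , eq , refl , sp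
  cutTwice (skipC e C) (suc i) (suc j) (s≤s i≤j) (s≤s j≤) with cutTwice C i j i≤j j≤
  ... | C₁ , B , C₃ , eq , sp₁ , sp =
    skipC e C₁ , B , C₃ , cong (skipC e) eq , cong suc sp₁ , cong suc sp
  cutTwice (inside e C e' d) (suc i) (suc j) (s≤s i≤j) (s≤s j≤) with cutTwice C i j i≤j j≤
  ... | C₁ , B , C₃ , eq , sp₁ , sp =
    inside e C₁ e' d , B , C₃ , cong (λ x → inside e x e' d) eq , cong suc sp₁ , cong suc sp
  cutTwice (after e d e' C) (suc i) (suc j) (s≤s i≤j) (s≤s j≤) with cutTwice C i j i≤j j≤
  ... | C₁ , B , C₃ , eq , sp₁ , sp =
    after e d e' C₁ , B , C₃ , cong (after e d e') eq , cong suc sp₁ , cong suc sp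

  -- Triples are coded injectively by Fin nTriples, for the pigeonhole principle.
  nTriples : ℕ
  nTriples = nQ ℕ.* (nΓ ℕ.* nQ)

  encode : Triple → Fin nTriples
  encode (q , γ , q') = F.combine q (F.combine γ q')

  encode-injective : ∀ {X Y} → encode X ≡ encode Y → X ≡ Y
  encode-injective {q , γ , q'} {r , δ , r'} eq with FP.combine-injective q _ r _ eq
  ... | refl , eq' with FP.combine-injective γ q' δ r' eq'
  ... | refl , refl = refl

  record Loop {X Y} (C : Ctx X Y) : Set where
    constructor loopAt
    field
      {Z}      : Triple
      before   : Ctx X Z
      loop     : Ctx Z Z
      rest     : Ctx Z Y
      split    : C ≡ before ∘C (loop ∘C rest)
      nonempty : 1 ≤ spine loop
      short    : spine loop ≤ nTriples

  -- Pigeonhole: among the first nTriples + 1 triples of a long spine two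
  -- coincide, and the part of the spine between them is a short loop.
  findLoop : ∀ {X Y} (C : Ctx X Y) → nTriples ≤ spine C → Loop C
  findLoop C N≤spine
    with FP.pigeonhole (ℕP.n<1+n nTriples) (λ i → encode (tripleAt C (toℕ i)))
  ... | i , j , i<j , same
    with cutTwice C (toℕ i) (toℕ j) (ℕP.<⇒≤ i<j) (ℕP.≤-trans (FP.toℕ≤pred[n] j) N≤spine)
  ... | C₁ , B , C₃ , split , spine₁ , spines =
    close (encode-injective same) B C₃ split
      (ℕP.+-cancelˡ-< (spine C₁) 0 (spine B)
        (subst₂ _<_ (trans (sym spine₁) (sym (ℕP.+-identityʳ _))) (sym spines) i<j))
      (ℕP.≤-trans (ℕP.m≤n+m (spine B) (spine C₁)) (subst (_≤ nTriples) (sym spines) (FP.toℕ≤pred[n] j)))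
    where
      close : ∀ {Z'} → tripleAt C (toℕ i) ≡ Z' → (B : Ctx (tripleAt C (toℕ i)) Z') (C₃ : Ctx Z' _) →
              C ≡ C₁ ∘C (B ∘C C₃) →
              1 ≤ spine B → spine B ≤ nTriples → Loop C
      close refl B C₃ = loopAt C₁ B C₃

nonpositive-+ : ∀ {b} y → b ℤ.≤ 0ℤ → b + y ℤ.≤ y
nonpositive-+ y b≤0 = ℤP.≤-trans (ℤP.+-monoˡ-≤ y b≤0) (ℤP.≤-reflexive (ℤP.+-identityˡ y))

module Excision {nQ nΓ : ℕ} (A : WPS nQ nΓ) where
  open Derivations A
  open Contexts A

  module _ {X Y Z} (C₁ : Ctx X Z) (B : Ctx Z Z) (C₃ : Ctx Z Y) where

    excise-cweight : cweight (C₁ ∘C (B ∘C C₃)) ≡ cweight B + cweight (C₁ ∘C C₃)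
    excise-cweight = begin
      cweight (C₁ ∘C (B ∘C C₃))               ≡⟨ cweight-∘ C₁ (B ∘C C₃) ⟩
      cweight C₁ + cweight (B ∘C C₃)          ≡⟨ cong (cweight C₁ +_) (cweight-∘ B C₃) ⟩
      cweight C₁ + (cweight B + cweight C₃)   ≡⟨ swap-+ (cweight C₁) (cweight B) (cweight C₃) ⟩
      cweight B + (cweight C₁ + cweight C₃)   ≡⟨ cong (cweight B +_) (sym (cweight-∘ C₁ C₃)) ⟩
      cweight B + cweight (C₁ ∘C C₃)          ∎
      where open ≡-Reasoning

    excise-dweight : ∀ t → dweight (plug (C₁ ∘C (B ∘C C₃)) t) ≡ cweight B + dweight (plug (C₁ ∘C C₃) t)
    excise-dweight t = begin
      dweight (plug (C₁ ∘C (B ∘C C₃)) t)          ≡⟨ dweight-plug (C₁ ∘C (B ∘C C₃)) t ⟩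
      cweight (C₁ ∘C (B ∘C C₃)) + dweight t       ≡⟨ cong (_+ dweight t) excise-cweight ⟩
      cweight B + cweight (C₁ ∘C C₃) + dweight t  ≡⟨ ℤP.+-assoc (cweight B) _ _ ⟩
      cweight B + (cweight (C₁ ∘C C₃) + dweight t) ≡⟨ cong (cweight B +_) (sym (dweight-plug (C₁ ∘C C₃) t)) ⟩
      cweight B + dweight (plug (C₁ ∘C C₃) t)     ∎
      where open ≡-Reasoning

    excise-nonpositive-cweight : cweight B ℤ.≤ 0ℤ → cweight (C₁ ∘C (B ∘C C₃)) ℤ.≤ cweight (C₁ ∘C C₃)
    excise-nonpositive-cweight B≤0 = subst (ℤ._≤ _) (sym excise-cweight) (nonpositive-+ _ B≤0)

    excise-nonpositive-dweight : cweight B ℤ.≤ 0ℤ → ∀ t →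
      dweight (plug (C₁ ∘C (B ∘C C₃)) t) ℤ.≤ dweight (plug (C₁ ∘C C₃) t)
    excise-nonpositive-dweight B≤0 t = subst (ℤ._≤ _) (sym (excise-dweight t)) (nonpositive-+ _ B≤0)

    excise-spine : 1 ≤ spine B → spine (C₁ ∘C C₃) < spine (C₁ ∘C (B ∘C C₃))
    excise-spine 1≤B rewrite spine-∘ C₁ C₃ | spine-∘ C₁ (B ∘C C₃) | spine-∘ B C₃ =
      ℕP.+-monoʳ-< (spine C₁) (ℕP.+-monoˡ-≤ (spine C₃) 1≤B)

    dsize-loop : ∀ t → dsize (plug (C₁ ∘C (B ∘C C₃)) t) ≡ csize C₁ ℕ.+ (csize B ℕ.+ dsize (plug C₃ t))
    dsize-loop t rewrite plug-∘ C₁ (B ∘C C₃) t | plug-∘ B C₃ t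
                       | dsize-plug C₁ (plug B (plug C₃ t)) | dsize-plug B (plug C₃ t) = refl

    excise-dsize : 1 ≤ spine B → ∀ t → dsize (plug (C₁ ∘C C₃) t) < dsize (plug (C₁ ∘C (B ∘C C₃)) t)
    excise-dsize 1≤B t rewrite dsize-loop t | plug-∘ C₁ C₃ t | dsize-plug C₁ (plug C₃ t) =
      ℕP.+-monoʳ-< (csize C₁) (ℕP.+-monoˡ-≤ (dsize (plug C₃ t)) (ℕP.≤-trans 1≤B (spine≤csize B)))

    loop-csize : ∀ t → csize B ≤ dsize (plug (C₁ ∘C (B ∘C C₃)) t)
    loop-csize t rewrite dsize-loop t =
      ℕP.≤-trans (ℕP.m≤m+n (csize B) _) (ℕP.m≤n+m _ (csize C₁))

module Reduction {nQ nΓ : ℕ} (A : WPS nQ nΓ) where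
  open WPS A
  open Derivations A
  open Contexts A
  open Excision A

  OffSmall : ∀ {X Y} → Ctx X Y → Set
  OffSmall hole = ⊤
  OffSmall (skipC _ C) = OffSmall C
  OffSmall (inside _ C _ d) = OffSmall C × height d ≤ nTriples
  OffSmall (after _ d _ C) = height d ≤ nTriples × OffSmall C

  offSmall-∘ : ∀ {X Y Z} (C : Ctx X Y) {C' : Ctx Y Z} → OffSmall C → OffSmall C' → OffSmall (C ∘C C')
  offSmall-∘ hole _ o' = o'
  offSmall-∘ (skipC e C) o o' = offSmall-∘ C o o'
  offSmall-∘ (inside e C e' d) (o , h) o' = offSmall-∘ C o o' , h
  offSmall-∘ (after e d e' C) (h , o) o' = h , offSmall-∘ C o o'

  offSmall-split : ∀ {X Y Z} (C : Ctx X Y) {C' : Ctx Y Z} → OffSmall (C ∘C C') → OffSmall C × OffSmall C'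
  offSmall-split hole o = tt , o
  offSmall-split (skipC e C) o = offSmall-split C o
  offSmall-split (inside e C e' d) (o , h) = let o₁ , o₂ = offSmall-split C o in (o₁ , h) , o₂
  offSmall-split (after e d e' C) (h , o) = let o₁ , o₂ = offSmall-split C o in (h , o₁) , o₂

  -- Short contexts: these are finitely many, so they can be enumerated.
  Small : ∀ {X Y} → Ctx X Y → Set
  Small C = spine C ≤ nTriples × OffSmall C

  record Pump (X : Triple) : Set where
    constructor pump
    field
      {Z}      : Triple
      outer    : Ctx X Z
      loop     : Ctx Z Z
      positive : 0ℤ ℤ.< cweight loop
      inner    : Deriv Z

  SmallPump : Triple → Set
  SmallPump X = Σ (Pump X) λ p → Small (Pump.loop p)

  pumpUnder : ∀ {X Y} → Ctx X Y → SmallPump Y → SmallPump X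
  pumpUnder C (pump O P pos T , small) = pump (C ∘C O) P pos T , small

  Dominated : ∀ {X} → Deriv X → Set
  Dominated {X} d = Σ (Deriv X) λ d' → height d' ≤ nTriples × dweight d ℤ.≤ dweight d'

  Reduction : ℕ → Set
  Reduction n = ∀ {X} (d : Deriv X) → dsize d ≤ n → Dominated d ⊎ SmallPump X

  Normalised : ∀ {X Y} → Ctx X Y → Set
  Normalised {X} {Y} C = Σ (Ctx X Y) λ C' → OffSmall C' × cweight C ℤ.≤ cweight C'

  excursion-mono : ∀ a b {x x' y y'} → x ℤ.≤ x' → y ℤ.≤ y' → a + (x + (b + y)) ℤ.≤ a + (x' + (b + y'))
  excursion-mono a b x≤ y≤ = ℤP.+-monoʳ-≤ a (ℤP.+-mono-≤ x≤ (ℤP.+-monoʳ-≤ b y≤))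

  -- Replace each off-spine subderivation of C by a dominating small one; a
  -- derivation T to plug into the hole is needed to place pumps found on the way.
  normalise : ∀ {n} → Reduction n → ∀ {Y Z} (C : Ctx Y Z) → csize C ≤ suc n → Deriv Z →
              Normalised C ⊎ SmallPump Y
  normalise reduce hole _ T = inj₁ (hole , tt , ℤP.≤-refl)
  normalise reduce (skipC {q} {γ} {q₁} e C) sz T with normalise reduce C (ℕP.≤-trans (ℕP.n≤1+n _) sz) T
  ... | inj₂ p = inj₂ (pumpUnder (skipC e hole) p)
  ... | inj₁ (C' , o , ≤C') = inj₁ (skipC e C' , o , ℤP.+-monoʳ-≤ (w q γ q₁ skip) ≤C')
  normalise reduce (inside {q} {γ} {q₁} {z} {q₂} {q₃} e C e' d) (s≤s sz) T
    with reduce d (ℕP.≤-trans (ℕP.m≤n+m _ _) sz)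
  ... | inj₂ p = inj₂ (pumpUnder (after e (plug C T) e' hole) p)
  ... | inj₁ (d' , h , ≤d') with normalise reduce C (ℕP.m≤n⇒m≤1+n (ℕP.≤-trans (ℕP.m≤m+n _ _) sz)) T
  ...   | inj₂ p = inj₂ (pumpUnder (inside e hole e' d) p)
  ...   | inj₁ (C' , o , ≤C') =
          inj₁ (inside e C' e' d' , (o , h) , excursion-mono (w q γ q₁ (push z)) (w q₂ z q₃ pop) ≤C' ≤d')
  normalise reduce (after {q} {γ} {q₁} {z} {q₂} {q₃} e d e' C) (s≤s sz) T
    with reduce d (ℕP.≤-trans (ℕP.m≤m+n _ _) sz)
  ... | inj₂ p = inj₂ (pumpUnder (inside e hole e' (plug C T)) p)
  ... | inj₁ (d' , h , ≤d') with normalise reduce C (ℕP.m≤n⇒m≤1+n (ℕP.≤-trans (ℕP.m≤n+m _ _) sz)) T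
  ...   | inj₂ p = inj₂ (pumpUnder (after e d e' hole) p)
  ...   | inj₁ (C' , o , ≤C') =
          inj₁ (after e d' e' C' , (h , o) , excursion-mono (w q γ q₁ (push z)) (w q₂ z q₃ pop) ≤d' ≤C')

  -- An off-small positive loop yields a small positive pump: cut out short
  -- loops from its spine; the first positive one, or the remainder once short
  -- enough, is the pump (m bounds the spine length).
  shorten : ∀ (m : ℕ) {Z} (P : Ctx Z Z) → spine P ≤ m → OffSmall P → 0ℤ ℤ.< cweight P → Deriv Z →
            SmallPump Z
  shorten m P sp off pos T with spine P ℕ.≤? nTriples
  ... | yes short = pump hole P pos T , short , off
  shorten zero P sp off pos T | no long = contradiction (ℕP.≤-trans sp z≤n) long
  shorten (suc m) P sp off pos T | no long with findLoop P (ℕP.<⇒≤ (ℕP.≰⇒> long))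
  ... | loopAt C₁ B C₃ refl nonempty short
    with offSmall-split C₁ off
  ... | o₁ , o₂ with offSmall-split B o₂
  ... | oB , o₃ with 0ℤ ℤ.<? cweight B
  ...   | yes posB = pump C₁ B posB (plug C₃ T) , short , oB
  ...   | no nposB =
          shorten m (C₁ ∘C C₃) (ℕP.≤-pred (ℕP.≤-trans (excise-spine C₁ B C₃ nonempty) sp))
            (offSmall-∘ C₁ o₁ o₃)
            (ℤP.<-≤-trans pos (excise-nonpositive-cweight C₁ B C₃ (ℤP.≮⇒≥ nposB)))
            T

  minimisePump : ∀ {n} → Reduction n → ∀ {Z} (P : Ctx Z Z) → csize P ≤ suc n →
                 0ℤ ℤ.< cweight P → Deriv Z → SmallPump Z
  minimisePump reduce P sz pos T with normalise reduce P sz T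
  ... | inj₂ p = p
  ... | inj₁ (P' , off , ≤P') = shorten (spine P') P' ℕP.≤-refl off (ℤP.<-≤-trans pos ≤P') T

  -- A derivation that is too high has a short loop on a long spine: a
  -- positive loop gives a pump, a non-positive one can be removed.
  reduce : ∀ n → Reduction n
  reduce zero stay _ = inj₁ (stay , z≤n , ℤP.≤-refl)
  reduce (suc n) d sz with height d ℕ.≤? nTriples
  ... | yes low = inj₁ (d , low , ℤP.≤-refl)
  ... | no high with deep nTriples d (ℕP.<⇒≤ (ℕP.≰⇒> high))
  ... | _ , C , t , spineN , refl with findLoop C (ℕP.≤-reflexive (sym spineN))
  ... | loopAt C₁ B C₃ refl nonempty _ with 0ℤ ℤ.<? cweight B
  ...   | yes posB =
          inj₂ (pumpUnder C₁ (minimisePump (reduce n) B (ℕP.≤-trans (loop-csize C₁ B C₃ t) sz) posB (plug C₃ t)))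
  ...   | no nposB with reduce n (plug (C₁ ∘C C₃) t) (ℕP.≤-pred (ℕP.≤-trans (excise-dsize C₁ B C₃ nonempty t) sz))
  ...     | inj₂ p = inj₂ p
  ...     | inj₁ (d' , low , ≤d') =
            inj₁ (d' , low , ℤP.≤-trans (excise-nonpositive-dweight C₁ B C₃ (ℤP.≮⇒≥ nposB) t) ≤d')

  -- Ignoring weights, every derivation and context can be made small by
  -- cutting out loops; this bounds the search for pumps.
  shrinkDeriv : ∀ n {X} (d : Deriv X) → dsize d ≤ n → Σ (Deriv X) λ d' → height d' ≤ nTriples
  shrinkDeriv zero stay _ = stay , z≤n
  shrinkDeriv (suc n) d sz with height d ℕ.≤? nTriples
  ... | yes low = d , low
  ... | no high with deep nTriples d (ℕP.<⇒≤ (ℕP.≰⇒> high))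
  ... | _ , C , t , spineN , refl with findLoop C (ℕP.≤-reflexive (sym spineN))
  ... | loopAt C₁ B C₃ refl nonempty _ =
    shrinkDeriv n (plug (C₁ ∘C C₃) t) (ℕP.≤-pred (ℕP.≤-trans (excise-dsize C₁ B C₃ nonempty t) sz))

  shrinkOff : ∀ {X Y} (C : Ctx X Y) → Σ (Ctx X Y) OffSmall
  shrinkOff hole = hole , tt
  shrinkOff (skipC e C) = let C' , o = shrinkOff C in skipC e C' , o
  shrinkOff (inside e C e' d) =
    let C' , o = shrinkOff C ; d' , h = shrinkDeriv _ d ℕP.≤-refl in inside e C' e' d' , o , h
  shrinkOff (after e d e' C) =
    let C' , o = shrinkOff C ; d' , h = shrinkDeriv _ d ℕP.≤-refl in after e d' e' C' , h , o

  shrinkSpine : ∀ (m : ℕ) {X Y} (C : Ctx X Y) → spine C ≤ m → OffSmall C → Σ (Ctx X Y) Small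
  shrinkSpine m C sp off with spine C ℕ.≤? nTriples
  ... | yes short = C , short , off
  shrinkSpine zero C sp off | no long = contradiction (ℕP.≤-trans sp z≤n) long
  shrinkSpine (suc m) C sp off | no long with findLoop C (ℕP.<⇒≤ (ℕP.≰⇒> long))
  ... | loopAt C₁ B C₃ refl nonempty _ with offSmall-split C₁ off
  ... | o₁ , o₂ = shrinkSpine m (C₁ ∘C C₃) (ℕP.≤-pred (ℕP.≤-trans (excise-spine C₁ B C₃ nonempty) sp))
                    (offSmall-∘ C₁ o₁ (proj₂ (offSmall-split B o₂)))

  shrinkCtx : ∀ {X Y} (C : Ctx X Y) → Σ (Ctx X Y) Small
  shrinkCtx C = let C' , o = shrinkOff C in shrinkSpine (spine C') C' ℕP.≤-refl o

module _ {X : Set} where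

  forEach : ∀ n → (Fin n → List X) → List X
  forEach n f = concatMap f (allFin n)

  ∈-forEach : ∀ {n} (f : Fin n → List X) {x} i → x ∈ f i → x ∈ forEach n f
  ∈-forEach f i x∈ = ∈-concatMap⁺ f (lose (∈-allFin i) x∈)

  when : (b : Bool) → (b ≡ true → List X) → List X
  when true f = f refl
  when false f = []

  ∈-when : ∀ {b} (f : b ≡ true → List X) {x} (e : b ≡ true) → x ∈ f e → x ∈ when b f
  ∈-when f refl x∈ = x∈

  Inhabited : List X → Set
  Inhabited = Any (λ _ → ⊤)

module Enumeration {nQ nΓ : ℕ} (A : WPS nQ nΓ) where
  open WPS A
  open Derivations A
  open Contexts A
  open Reduction A

  _≟T_ : (X Y : Triple) → Dec (X ≡ Y)
  _≟T_ = ≡-dec FP._≟_ (≡-dec FP._≟_ FP._≟_)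

  allTriples : List Triple
  allTriples = forEach nQ λ q → forEach nΓ λ γ → forEach nQ λ q' → (q , γ , q') ∷ []

  ∈-allTriples : ∀ X → X ∈ allTriples
  ∈-allTriples (q , γ , q') =
    ∈-forEach _ q (∈-forEach _ γ (∈-forEach (λ q' → (q , γ , q') ∷ []) q' (here refl)))

  forEachExcursion : ∀ {L : Set} q γ →
    (∀ z q₁ q₂ q₃ → isEdge q γ q₁ (push z) ≡ true → isEdge q₂ z q₃ pop ≡ true → List L) → List L
  forEachExcursion q γ f =
    forEach nΓ λ z → forEach nQ λ q₁ → forEach nQ λ q₂ → forEach nQ λ q₃ →
    when (isEdge q γ q₁ (push z)) λ e → when (isEdge q₂ z q₃ pop) λ e' → f z q₁ q₂ q₃ e e'

  ∈-forEachExcursion : ∀ {L : Set} {q γ} f {x : L} {z q₁ q₂ q₃}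
    (e : isEdge q γ q₁ (push z) ≡ true) (e' : isEdge q₂ z q₃ pop ≡ true) →
    x ∈ f z q₁ q₂ q₃ e e' → x ∈ forEachExcursion q γ f
  ∈-forEachExcursion f {z = z} {q₁} {q₂} {q₃} e e' x∈ =
    ∈-forEach _ z (∈-forEach _ q₁ (∈-forEach _ q₂ (∈-forEach _ q₃ (∈-when _ e (∈-when _ e' x∈)))))

  stays : ∀ X → List (Deriv X)
  stays (q , γ , q') with q FP.≟ q'
  ... | yes refl = stay ∷ []
  ... | no _ = []

  ∈-stays : ∀ {q γ} → stay ∈ stays (q , γ , q)
  ∈-stays {q} with q FP.≟ q
  ... | yes refl = here refl
  ... | no q≢q = contradiction refl q≢q

  derivs : ℕ → ∀ X → List (Deriv X)
  skips excursions : ℕ → ∀ X → List (Deriv X)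

  derivs zero X = stays X
  derivs (suc h) X = stays X ++ (skips h X ++ excursions h X)

  skips h (q , γ , q₄) =
    forEach nQ λ q₁ → when (isEdge q γ q₁ skip) λ e → map (skipD e) (derivs h (q₁ , γ , q₄))

  excursions h (q , γ , q₄) = forEachExcursion q γ λ z q₁ q₂ q₃ e e' →
    concatMap (λ d → map (excursion e d e') (derivs h (q₃ , γ , q₄))) (derivs h (q₁ , z , q₂))

  derivs-complete : ∀ h {X} (d : Deriv X) → height d ≤ h → d ∈ derivs h X
  derivs-complete zero stay _ = ∈-stays
  derivs-complete (suc h) stay _ = ∈-++⁺ˡ ∈-stays
  derivs-complete (suc h) {X} (skipD {q₁ = q₁} e d) (s≤s hd) =
    ∈-++⁺ʳ (stays X) (∈-++⁺ˡ (∈-forEach _ q₁ (∈-when _ e (∈-map⁺ (skipD e) (derivs-complete h d hd)))))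
  derivs-complete (suc h) {X} (excursion e d e' d') (s≤s hd) =
    ∈-++⁺ʳ (stays X) (∈-++⁺ʳ (skips h X) (∈-forEachExcursion _ e e' (∈-concatMap⁺ _
      (lose (derivs-complete h d (ℕP.≤-trans (ℕP.m≤m⊔n _ _) hd))
            (∈-map⁺ (excursion e d e') (derivs-complete h d' (ℕP.≤-trans (ℕP.m≤n⊔m _ _) hd)))))))

  holes : ∀ X Y → List (Ctx X Y)
  holes X Y with X ≟T Y
  ... | yes refl = hole ∷ []
  ... | no _ = []

  ∈-holes : ∀ {X} → hole ∈ holes X X
  ∈-holes {X} with X ≟T X
  ... | yes refl = here refl
  ... | no X≢X = contradiction refl X≢X

  ctxs : ℕ → ∀ X Y → List (Ctx X Y)
  skipCtxs insideCtxs afterCtxs : ℕ → ∀ X Y → List (Ctx X Y)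

  ctxs zero X Y = holes X Y
  ctxs (suc a) X Y = holes X Y ++ (skipCtxs a X Y ++ (insideCtxs a X Y ++ afterCtxs a X Y))

  skipCtxs a (q , γ , q₄) Y =
    forEach nQ λ q₁ → when (isEdge q γ q₁ skip) λ e → map (skipC e) (ctxs a (q₁ , γ , q₄) Y)

  insideCtxs a (q , γ , q₄) Y = forEachExcursion q γ λ z q₁ q₂ q₃ e e' →
    concatMap (λ C → map (inside e C e') (derivs nTriples (q₃ , γ , q₄))) (ctxs a (q₁ , z , q₂) Y)

  afterCtxs a (q , γ , q₄) Y = forEachExcursion q γ λ z q₁ q₂ q₃ e e' →
    concatMap (λ d → map (after e d e') (ctxs a (q₃ , γ , q₄) Y)) (derivs nTriples (q₁ , z , q₂))

  ctxs-complete : ∀ a {X Y} (C : Ctx X Y) → spine C ≤ a → OffSmall C → C ∈ ctxs a X Y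
  ctxs-complete zero hole _ _ = ∈-holes
  ctxs-complete (suc a) hole _ _ = ∈-++⁺ˡ ∈-holes
  ctxs-complete (suc a) {X} {Y} (skipC {q₁ = q₁} e C) (s≤s sp) o =
    ∈-++⁺ʳ (holes X Y) (∈-++⁺ˡ (∈-forEach _ q₁ (∈-when _ e (∈-map⁺ (skipC e) (ctxs-complete a C sp o)))))
  ctxs-complete (suc a) {X} {Y} (inside e C e' d) (s≤s sp) (o , h) =
    ∈-++⁺ʳ (holes X Y) (∈-++⁺ʳ (skipCtxs a X Y) (∈-++⁺ˡ (∈-forEachExcursion _ e e' (∈-concatMap⁺ _
      (lose (ctxs-complete a C sp o) (∈-map⁺ (inside e C e') (derivs-complete nTriples d h)))))))
  ctxs-complete (suc a) {X} {Y} (after e d e' C) (s≤s sp) (h , o) =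
    ∈-++⁺ʳ (holes X Y) (∈-++⁺ʳ (skipCtxs a X Y) (∈-++⁺ʳ (insideCtxs a X Y) (∈-forEachExcursion _ e e'
      (∈-concatMap⁺ _ (lose (derivs-complete nTriples d h) (∈-map⁺ (after e d e') (ctxs-complete a C sp o)))))))

  Pumpable : Triple → Set
  Pumpable X = Any (λ Z → Inhabited (ctxs nTriples X Z) × Inhabited (derivs nTriples Z) ×
                          Any (λ P → 0ℤ ℤ.< cweight P) (ctxs nTriples Z Z)) allTriples

  pumpable? : ∀ X → Dec (Pumpable X)
  pumpable? X = any? (λ Z → any? (λ _ → yes tt) _ ×-dec any? (λ _ → yes tt) _ ×-dec
                             any? (λ P → 0ℤ ℤ.<? cweight P) _) allTriples

  pumpable⇒pump : ∀ {X} → Pumpable X → Pump X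
  pumpable⇒pump p with Any.satisfied p
  ... | Z , outer , inner , loop =
    pump (proj₁ (Any.satisfied outer)) (proj₁ (Any.satisfied loop)) (proj₂ (Any.satisfied loop))
         (proj₁ (Any.satisfied inner))

  smallPump⇒pumpable : ∀ {X} → SmallPump X → Pumpable X
  smallPump⇒pumpable {X} (pump {Z} O P pos T , sp , off) =
    lose (∈-allTriples Z)
      (lose (uncurry (ctxs-complete nTriples O') (proj₂ (shrinkCtx O))) tt ,
       lose (derivs-complete nTriples T' (proj₂ (shrinkDeriv _ T ℕP.≤-refl))) tt ,
       lose (ctxs-complete nTriples P sp off) pos)
    where O' = proj₁ (shrinkCtx O)
          T' = proj₁ (shrinkDeriv _ T ℕP.≤-refl)

module Values {nQ nΓ : ℕ} (A : WPS nQ nΓ) where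

  _⊕ω_ : ℤω A → ℤω A → ℤω A
  _⊕ω_ = _⊕_ A

  infixr 6 _⊕ω_

  ⊕-assoc : ∀ a b c → (a ⊕ω b) ⊕ω c ≡ a ⊕ω (b ⊕ω c)
  ⊕-assoc (fin a) (fin b) (fin c) = cong fin (ℤP.+-assoc a b c)
  ⊕-assoc (fin a) (fin b) ω = refl
  ⊕-assoc (fin a) ω c = refl
  ⊕-assoc ω b c = refl

  ⊕-identityˡ : ∀ a → fin 0ℤ ⊕ω a ≡ a
  ⊕-identityˡ (fin a) = cong fin (ℤP.+-identityˡ a)
  ⊕-identityˡ ω = refl

  Positive : ℤω A → Set
  Positive = PositiveWeight A

  positive-split : ∀ a b c → Positive (a ⊕ω (b ⊕ω c)) → Positive b ⊎ Positive (a ⊕ω c)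
  positive-split a ω c _ = inj₁ refl
  positive-split ω (fin b) c _ = inj₂ refl
  positive-split (fin a) (fin b) ω _ = inj₂ refl
  positive-split (fin a) (fin b) (fin c) pos with 0ℤ ℤ.<? b
  ... | yes b>0 = inj₁ b>0
  ... | no b≯0 = inj₂ (ℤP.<-≤-trans pos (begin
      a + (b + c) ≡⟨ swap-+ a b c ⟩
      b + (a + c) ≤⟨ ℤP.+-monoˡ-≤ (a + c) (ℤP.≮⇒≥ b≯0) ⟩
      0ℤ + (a + c) ≡⟨ ℤP.+-identityˡ (a + c) ⟩
      a + c ∎))
    where open ℤP.≤-Reasoning

  data _≤ω_ : ℤ → ℤω A → Set where
    below-fin : ∀ {x k} → x ℤ.≤ k → x ≤ω fin k
    below-ω   : ∀ {x} → x ≤ω ω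

  infix 4 _≤ω_

  positive-≤ω : ∀ {x v} → 0ℤ ℤ.< x → x ≤ω v → Positive v
  positive-≤ω x>0 (below-fin x≤) = ℤP.<-≤-trans x>0 x≤
  positive-≤ω x>0 below-ω = refl

  positive⇒1≤ω : ∀ v → Positive v → ℤ.+ 1 ≤ω v
  positive⇒1≤ω (fin k) k>0 = below-fin (ℤP.i<j⇒suc[i]≤j k>0)
  positive⇒1≤ω ω _ = below-ω

  ≤ω-⊕ : ∀ {x y v v'} → x ≤ω v → y ≤ω v' → x + y ≤ω v ⊕ω v'
  ≤ω-⊕ (below-fin x≤) (below-fin y≤) = below-fin (ℤP.+-mono-≤ x≤ y≤)
  ≤ω-⊕ (below-fin _) below-ω = below-ω
  ≤ω-⊕ below-ω _ = below-ω

  ≤ω-split : ∀ {t} v v' → t ≤ω v ⊕ω v' →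
    Σ ℤ λ t₁ → Σ ℤ λ t₂ → t₁ ≤ω v × t₂ ≤ω v' × t ℤ.≤ t₁ + t₂
  ≤ω-split (fin k) (fin k') (below-fin t≤) = k , k' , below-fin ℤP.≤-refl , below-fin ℤP.≤-refl , t≤
  ≤ω-split {t} (fin k) ω below-ω =
    k , t - k , below-fin ℤP.≤-refl , below-ω , ℤP.≤-reflexive (sym (restore k t))
    where restore : ∀ k t → k + (t - k) ≡ t
          restore = solve-∀
  ≤ω-split {t} ω v' below-ω with someBelow v'
    where someBelow : ∀ v → Σ ℤ (_≤ω v)
          someBelow (fin k) = k , below-fin ℤP.≤-refl
          someBelow ω = 0ℤ , below-ω
  ... | t₂ , t₂≤ = t - t₂ , t₂ , below-ω , t₂≤ , ℤP.≤-reflexive (sym (restore t t₂))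
    where restore : ∀ t s → (t - s) + s ≡ t
          restore = solve-∀

i≤∣i∣ : ∀ i → i ℤ.≤ ℤ.+ ∣ i ∣
i≤∣i∣ (ℤ.+ n) = ℤP.≤-refl
i≤∣i∣ ℤ.-[1+ n ] = ℤ.-≤+

module Summaries {nQ nΓ : ℕ} (A : WPS nQ nΓ) where
  open WPS A
  open Derivations A
  open Contexts A
  open Reduction A
  open Enumeration A
  open Values A

  derivation⇒path : ∀ {q₁ γ q₂} (d : Deriv (q₁ , γ , q₂)) →
    Σ (Path A (base A γ q₁) (base A γ q₂)) λ p → NonDecreasing A p × weight A p ≡ dweight d
  derivation⇒path d = let p , wp , above = derivPath (bot ∷ []) d in p , above , wp

  path⇒derivation : ∀ {q₁ γ q₂} (p : Path A (base A γ q₁) (base A γ q₂)) → NonDecreasing A p →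
    Σ (Deriv (q₁ , γ , q₂)) λ d → dweight d ≡ weight A p
  path⇒derivation p nd = let u , wu = parse p nd ; d , wd = flatAscent u in d , trans wd wu

  iterate : ∀ {Z} → ℕ → Ctx Z Z → Ctx Z Z
  iterate zero P = hole
  iterate (suc m) P = P ∘C iterate m P

  iterate-weight : ∀ {Z} m (P : Ctx Z Z) → 0ℤ ℤ.< cweight P → ℤ.+ m ℤ.≤ cweight (iterate m P)
  iterate-weight zero P pos = ℤP.≤-refl
  iterate-weight (suc m) P pos rewrite cweight-∘ P (iterate m P) =
    ℤP.+-mono-≤ (ℤP.i<j⇒suc[i]≤j pos) (iterate-weight m P pos)

  pump⇒ω : ∀ {q₁ γ q₂} → Pump (q₁ , γ , q₂) → IsSummary A q₁ γ q₂ ω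
  pump⇒ω (pump O P pos T) n =
    let p , nd , wp = derivation⇒path pumped in p , nd , subst (n ℤ.≤_) (sym wp) heavy
    where
      m = ∣ n - (cweight O + dweight T) ∣
      pumped = plug O (plug (iterate m P) T)
      heavy : n ℤ.≤ dweight pumped
      heavy rewrite dweight-plug O (plug (iterate m P) T) | dweight-plug (iterate m P) T =
        subst (ℤ._≤ cweight O + (cweight (iterate m P) + dweight T)) (cancel (cweight O) (dweight T) n)
          (ℤP.+-monoʳ-≤ (cweight O) (ℤP.+-monoˡ-≤ (dweight T)
            (ℤP.≤-trans (i≤∣i∣ (n - (cweight O + dweight T))) (iterate-weight m P pos))))
        where cancel : ∀ a b x → a + ((x - (a + b)) + b) ≡ x
              cancel = solve-∀

  -- Without a pump, the heaviest of the finitely many small derivations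
  -- dominates every derivation, so it realises the finite summary.
  noPump⇒max : ∀ {q₁ γ q₂} → ¬ Pumpable (q₁ , γ , q₂) → (d : Deriv (q₁ , γ , q₂)) →
    Σ ℤ λ k → IsSummary A q₁ γ q₂ (fin k) × dweight d ℤ.≤ k
  noPump⇒max {q₁} {γ} {q₂} noPump d =
    dweight heaviest , (reached , λ p nd → bounded p nd) , f[⊥]≤f[argmax] {f = dweight} d (derivs nTriples _)
    where
      heaviest = argmax dweight d (derivs nTriples (q₁ , γ , q₂))

      dominated : ∀ d' → dweight d' ℤ.≤ dweight heaviest
      dominated d' with reduce _ d' ℕP.≤-refl
      ... | inj₂ small = contradiction (smallPump⇒pumpable small) noPump
      ... | inj₁ (d'' , low , ≤d'') =
        ℤP.≤-trans ≤d'' (All.lookup (f[xs]≤f[argmax] {f = dweight} d _) (derivs-complete nTriples d'' low))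

      reached : Σ (Path A (base A γ q₁) (base A γ q₂)) λ p → NonDecreasing A p × weight A p ≡ dweight heaviest
      reached = derivation⇒path heaviest

      bounded : ∀ p → NonDecreasing A p → weight A p ℤ.≤ dweight heaviest
      bounded p nd = let d' , wd' = path⇒derivation p nd in subst (ℤ._≤ _) wd' (dominated d')

  summaryOf : ∀ {q₁ γ q₂} (d : Deriv (q₁ , γ , q₂)) → Σ (ℤω A) λ v → IsSummary A q₁ γ q₂ v × dweight d ≤ω v
  summaryOf {q₁} {γ} {q₂} d with pumpable? (q₁ , γ , q₂)
  ... | yes pumpable = ω , pump⇒ω (pumpable⇒pump pumpable) , below-ω
  ... | no noPump = let k , summary , ≤k = noPump⇒max noPump d in fin k , summary , below-fin ≤k

  summaryPath : ∀ {q₁ γ q₂ v t} → IsSummary A q₁ γ q₂ v → t ≤ω v →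
    Σ (Path A (base A γ q₁) (base A γ q₂)) λ p → NonDecreasing A p × t ℤ.≤ weight A p
  summaryPath ((p , nd , wp) , _) (below-fin t≤k) = p , nd , subst (_ ℤ.≤_) (sym wp) t≤k
  summaryPath unbounded below-ω = unbounded _

  relocate : ∀ β {q₁ γ q₂} (p : Path A (base A γ q₁) (base A γ q₂)) → NonDecreasing A p →
    Σ (Path A (cfg β γ q₁) (cfg β γ q₂)) λ p' →
      weight A p' ≡ weight A p × All (Above (β ∷ʳ γ)) (configs A p')
  relocate β p nd =
    let d , wd = path⇒derivation p nd ; p' , wp' , above = derivPath β d in p' , trans wp' wd , above

middle-shorter : ∀ a b c → 1 ≤ a ⊎ 1 ≤ c → b < a ℕ.+ (b ℕ.+ c)
middle-shorter a b c (inj₁ 1≤a) = ℕP.+-mono-≤ 1≤a (ℕP.m≤m+n b c)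
middle-shorter a b c (inj₂ 1≤c) =
  ℕP.≤-trans (subst (_≤ b ℕ.+ c) (ℕP.+-comm b 1) (ℕP.+-monoʳ-≤ b 1≤c)) (ℕP.m≤n+m _ a)

outer-shorter : ∀ a b c → 1 ≤ b → a ℕ.+ c < a ℕ.+ (b ℕ.+ c)
outer-shorter a b c 1≤b = ℕP.+-monoʳ-< a (ℕP.+-monoˡ-≤ c 1≤b)

outer-nonempty : ∀ a c → 1 ≤ a ⊎ 1 ≤ c → 1 ≤ a ℕ.+ c
outer-nonempty a c (inj₁ 1≤a) = ℕP.≤-trans 1≤a (ℕP.m≤m+n a c)
outer-nonempty a c (inj₂ 1≤c) = ℕP.≤-trans 1≤c (ℕP.m≤n+m c a)

module SimpleCycles {nQ nΓ : ℕ} (A : WPS nQ nΓ) where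

  open Values A

  _≟V_ : (u v : Vertex A) → Dec (u ≡ v)
  _≟V_ = ≡-dec FP._≟_ FP._≟_

  open import Data.List.Membership.DecPropositional _≟V_ using (_∈?_)

  _++W_ : ∀ {u v x} → GrWalk A u v → GrWalk A v x → GrWalk A u x
  nil ++W p' = p'
  cons e p ++W p' = cons e (p ++W p')

  len : ∀ {u x} → GrWalk A u x → ℕ
  len nil = 0
  len (cons e p) = suc (len p)

  len-++ : ∀ {u v x} (p : GrWalk A u v) (p' : GrWalk A v x) → len (p ++W p') ≡ len p ℕ.+ len p'
  len-++ nil p' = refl
  len-++ (cons e p) p' = cong suc (len-++ p p')

  walkWeight-++ : ∀ {u v x} (p : GrWalk A u v) (p' : GrWalk A v x) →
                  walkWeight A (p ++W p') ≡ walkWeight A p ⊕ω walkWeight A p'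
  walkWeight-++ nil p' = sym (⊕-identityˡ _)
  walkWeight-++ (cons {a = a} e p) p' rewrite walkWeight-++ p p' =
    sym (⊕-assoc a (walkWeight A p) (walkWeight A p'))

  record Detour {u x} (p : GrWalk A u x) : Set where
    constructor detour
    field
      {y}       : Vertex A
      pre       : GrWalk A u y
      cycle     : GrWalk A y y
      post      : GrWalk A y x
      split     : p ≡ pre ++W (cycle ++W post)
      cycle≠nil : 1 ≤ len cycle
      rest≠nil  : 1 ≤ len pre ⊎ 1 ≤ len post

  splitAt : ∀ {u v x} (p : GrWalk A v x) → u ∈ walkVertices A p →
    Σ (GrWalk A v u) λ p₁ → Σ (GrWalk A u x) λ p₂ → p ≡ p₁ ++W p₂ × 1 ≤ len p₂
  splitAt (cons e p) (here refl) = nil , cons e p , refl , s≤s z≤n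
  splitAt (cons e p) (there u∈) with splitAt p u∈
  ... | p₁ , p₂ , eq , nonempty = cons e p₁ , p₂ , cong (cons e) eq , nonempty

  -- Every walk is simple or has a detour: scanning from the front, the first
  -- vertex that occurs again closes the detour's cycle.
  simpleOrDetour : ∀ {u x} (p : GrWalk A u x) → Unique (walkVertices A p) ⊎ Detour p
  simpleOrDetour nil = inj₁ []
  simpleOrDetour (cons {u} e p) with simpleOrDetour p
  ... | inj₂ (detour pre cyc post eq cyc≠nil _) =
    inj₂ (detour (cons e pre) cyc post (cong (cons e) eq) cyc≠nil (inj₁ (s≤s z≤n)))
  ... | inj₁ simple with u ∈? walkVertices A p
  ...   | no u∉ = inj₁ (¬Any⇒All¬ _ u∉ ∷ simple)
  ...   | yes u∈ with splitAt p u∈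
  ...     | p₁ , p₂ , refl , p₂≠nil = inj₂ (detour nil (cons e p₁) p₂ refl (s≤s z≤n) (inj₂ p₂≠nil))

  -- Induction on the length n of a positive closed walk: either it is simple,
  -- or it splits into two shorter closed walks one of which is positive.
  positiveSimpleCycle : ∀ (n : ℕ) {v} (c : GrWalk A v v) → len c ≤ n → 1 ≤ len c →
    Positive (walkWeight A c) → HasPositiveSimpleCycle A
  positiveSimpleCycle n {v} c len≤ c≠nil pos with simpleOrDetour c
  ... | inj₁ simple = simpleCycle c c≠nil simple pos
    where simpleCycle : (c : GrWalk A v v) → 1 ≤ len c → Unique (walkVertices A c) →
                        Positive (walkWeight A c) → HasPositiveSimpleCycle A
          simpleCycle (cons e p) _ simple pos = v , cons e p , simple , pos
  positiveSimpleCycle zero c len≤ c≠nil pos | inj₂ _ = ⊥-elim (ℕP.<-irrefl refl (ℕP.≤-trans c≠nil len≤))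
  positiveSimpleCycle (suc n) c len≤ c≠nil pos | inj₂ (detour pre cyc post refl cyc≠nil rest≠nil)
    rewrite walkWeight-++ pre (cyc ++W post) | walkWeight-++ cyc post
          | len-++ pre (cyc ++W post) | len-++ cyc post
    with positive-split (walkWeight A pre) (walkWeight A cyc) (walkWeight A post) pos
  ... | inj₁ cyc>0 =
    positiveSimpleCycle n cyc (ℕP.≤-pred (ℕP.≤-trans (middle-shorter _ _ _ rest≠nil) len≤)) cyc≠nil cyc>0
  ... | inj₂ rest>0 =
    positiveSimpleCycle n (pre ++W post)
      (subst (_≤ n) (sym (len-++ pre post)) (ℕP.≤-pred (ℕP.≤-trans (outer-shorter (len pre) _ (len post) cyc≠nil) len≤)))
      (subst (1 ≤_) (sym (len-++ pre post)) (outer-nonempty (len pre) (len post) rest≠nil))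
      (subst Positive (sym (walkWeight-++ pre post)) rest>0)

module Directions {nQ nΓ : ℕ} (A : WPS nQ nΓ) where
  open WPS A
  open Derivations A
  open Values A
  open Summaries A
  open SimpleCycles A

  -- An ascent is traced in the summary graph by a nonempty walk: each
  -- derivation by a skip-edge, each climb by a push-edge.
  ascentWalk : ∀ {β q γ c} (u : Ascent β q γ c) →
    Σ (GrWalk A (q , γ) (Config.state c , Config.top c)) λ walk →
      1 ≤ len walk × aweight u ≤ω walkWeight A walk
  ascentWalk (level d) =
    let v , summary , d≤v = summaryOf d
    in cons (skipE v summary) nil , s≤s z≤n ,
       subst (_≤ω v ⊕ω fin 0ℤ) (ℤP.+-identityʳ (dweight d)) (≤ω-⊕ d≤v (below-fin ℤP.≤-refl))
  ascentWalk (climb d e u) =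
    let v , summary , d≤v = summaryOf d ; walk , _ , u≤ = ascentWalk u
    in cons (skipE v summary) (cons (pushE e) walk) , s≤s z≤n , ≤ω-⊕ d≤v (≤ω-⊕ (below-fin ℤP.≤-refl) u≤)

  -- A good cycle parses as an ascent from (q, γ) back to state q with γ on
  -- top, whose walk is a positive closed walk of Gr(A).
  goodCycle⇒positiveCycle : HasGoodCycle A → HasPositiveSimpleCycle A
  goodCycle⇒positiveCycle (cfg β γ q , cfg _ _ _ , p , pos , nd , refl , refl) =
    let u , wu = parse p nd ; walk , walk≠nil , u≤walk = ascentWalk u
    in positiveSimpleCycle (len walk) walk ℕP.≤-refl walk≠nil
         (positive-≤ω pos (subst (_≤ω walkWeight A walk) wu u≤walk))

  walkPath : ∀ {q γ x} (walk : GrWalk A (q , γ) x) (β : List (Fin nΓ)) (t : ℤ) →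
    t ≤ω walkWeight A walk →
    Σ (Config A) λ e → Σ (Path A (cfg β γ q) e) λ p → (Config.state e , Config.top e) ≡ x ×
      All (Above (β ∷ʳ γ)) (configs A p) × t ℤ.≤ weight A p
  walkPath {q} {γ} nil β t (below-fin t≤0) =
    cfg β γ q , [ cfg β γ q ] , refl , prefix-refl (β ∷ʳ γ) ∷ [] , t≤0
  walkPath (cons (skipE v summary) rest) β t t≤ with ≤ω-split v (walkWeight A rest) t≤
  ... | t₁ , t₂ , t₁≤ , t₂≤ , t≤t₁+t₂ with summaryPath summary t₁≤
  ... | p₀ , nd , t₁≤p₀ with relocate β p₀ nd | walkPath rest β t₂ t₂≤
  ... | p₁ , wp₁ , above₁ | e , p₂ , end , above₂ , t₂≤p₂ =
    e , p₁ ++P p₂ , end , all-++P p₁ p₂ above₁ above₂ ,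
    ℤP.≤-trans t≤t₁+t₂ (subst (_ ℤ.≤_) (sym (weight-++ p₁ p₂))
                          (ℤP.+-mono-≤ (subst (t₁ ℤ.≤_) (sym wp₁) t₁≤p₀) t₂≤p₂))
  walkPath {γ = γ} (cons (pushE e) rest) β t t≤ with ≤ω-split _ (walkWeight A rest) t≤
  ... | t₁ , t₂ , below-fin t₁≤ , t₂≤ , t≤t₁+t₂ with walkPath rest (β ∷ʳ γ) t₂ t₂≤
  ... | e' , p , end , above , t₂≤p =
    e' , pushS e ◅ p , end ,
    prefix-refl (β ∷ʳ γ) ∷ All.map (prefix-trans (prefix-snoc (β ∷ʳ γ) _)) above ,
    ℤP.≤-trans t≤t₁+t₂ (ℤP.+-mono-≤ t₁≤ t₂≤p)

  positiveCycle⇒goodCycle : HasPositiveSimpleCycle A → HasGoodCycle A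
  positiveCycle⇒goodCycle ((q , γ) , cycle , _ , pos)
    with walkPath cycle [] (ℤ.+ 1) (positive⇒1≤ω (walkWeight A cycle) pos)
  ... | e , p , refl , above , 1≤p = cfg [] γ q , e , p , ℤP.<-≤-trans (ℤ.+<+ (s≤s z≤n)) 1≤p , above , refl , refl

lemma10 : ∀ {nQ nΓ : ℕ} (A : WPS nQ nΓ) →
    HasGoodCycle A ⇔ HasPositiveSimpleCycle A
lemma10 A = mk⇔ goodCycle⇒positiveCycle positiveCycle⇒goodCycle
  where open Directions A
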